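{- Assume $H$ contains a connected component that is not a clique. Then, for any $t$-boundaried graph $(G,\lambda)$ there exists an equivalent $t$-boundaried graph $(\widehat{G},\lambda)$ such that (a) $(\widehat{G},\lambda)$ is a subgraph of $(G,\lambda)$, (b) $\partial G = \partial \widehat{G}$ and $G[\partial G] = \widehat{G}[\partial \widehat{G}]$, and (c) $\widehat{G} \setminus E(\widehat{G}[\partial \widehat{G}])$ contains $\mathcal{O}(t^{\mu^\star(H)})$ vertices and edges.
   Context: $H$ is a fixed pattern graph; constants hidden in the $\mathcal{O}$-notation may depend on $H$. A $t$-boundaried graph is a graph $G$ with a boundary $\partial G \subseteq V(G)$, $|\partial G| \le t$, and an injective labeling $\lambda_G:\partial G \to \{1,\dots,t\}$. For an induced subgraph $H'=H[D]$ of $H$, its boundary is $\partial H' = N_H(V(H)\setminus D)$ and its interior is $\mathrm{int}\, H' = D\setminus \partial H'$. $H'$ is a slice if $N_H(\mathrm{int}\, H') = \partial H'$, and a chunk if additionally $H[\mathrm{int}\, H']$ is connected. A slice (chunk) equipped with an injective labeling of its boundary into $\{1,\dots,t\}$ is a $t$-slice ($t$-chunk), viewed as a $t$-boundaried graph. $\mu^\star(H)$ is the maximum of $|\partial \mathbf{c}|$ over all chunks $\mathbf{c}$ of $H$. For $t$-boundaried graphs $F$ and $G$, an $F$-subgraph of $G$ is an injective homomorphism $\pi:V(F)\to V(G)$ such that every $a\in\partial F$ is mapped to $\pi(a)\in\partial G$ with the same label (vertices of $V(F)\setminus\partial F$ may be mapped into $\partial G$). The profile of a $t$-boundaried graph is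 the set of all $t$-slices that are subgraphs of it; the $(\le p)$-profile restricts to $t$-slices with at most $p$ vertices. The extended profile of $(G,\lambda)$ consists, for every $Y\subseteq \partial G$ with $|Y|\le |V(H)|$, of the $(\le |V(H)|-|Y|)$-profile $\mathbb{P}^{G,\lambda}_Y$ of $(G\setminus Y, \lambda|_{\partial G\setminus Y})$. $(G_1,\lambda_1)$ is a witness-subgraph of $(G_2,\lambda_2)$ if $\partial G_1=\partial G_2$, $\lambda_1=\lambda_2$, and $\mathbb{P}^{G_1,\lambda_1}_Y\subseteq \mathbb{P}^{G_2,\lambda_2}_Y$ for every such $Y$; two $t$-boundaried graphs are equivalent if each is a witness-subgraph of the other (same boundary, labeling, and extended profiles). -}

module Defs where

open import Data.Nat using (ℕ; zero; suc; _+_; _*_; _∸_; _^_; _≤_)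
open import Data.Bool using (Bool; true; false; _∧_; _∨_; not; if_then_else_)
open import Data.Fin using (Fin; zero; suc)
open import Data.Maybe using (Maybe; just; nothing; is-just)
open import Data.Product using (Σ; _×_; _,_)
open import Function using (_∘_)
open import Relation.Binary.PropositionalEquality using (_≡_; _≢_)

record Graph : Set where
  field
    size    : ℕ
    adj     : Fin size → Fin size → Bool
    adj-sym : ∀ u v → adj u v ≡ adj v u
    adj-irr : ∀ v → adj v v ≡ false
open Graph public

sumF : ∀ {n} → (Fin n → ℕ) → ℕ
sumF {zero}  f = 0
sumF {suc n} f = f zero + sumF (f ∘ suc)

anyF : ∀ {n} → (Fin n → Bool) → Bool
anyF {zero}  f = false
anyF {suc n} f = f zero ∨ anyF (f ∘ suc)

count : ∀ {n} → (Fin n → Bool) → ℕ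
count X = sumF (λ v → if X v then 1 else 0)

countPairs : ∀ {n} → (Fin n → Fin n → Bool) → ℕ
countPairs R = sumF (λ u → count (R u))

module _ (H : Graph) where

  nbr : (Fin (size H) → Bool) → Fin (size H) → Bool
  nbr X v = not (X v) ∧ anyF (λ u → X u ∧ adj H u v)

  bnd : (Fin (size H) → Bool) → Fin (size H) → Bool
  bnd D = nbr (λ u → not (D u))

  int : (Fin (size H) → Bool) → Fin (size H) → Bool
  int D v = D v ∧ not (bnd D v)

  IsSlice : (Fin (size H) → Bool) → Set
  IsSlice D = ∀ v → nbr (int D) v ≡ bnd D v

  data Reach (X : Fin (size H) → Bool) (u : Fin (size H)) : Fin (size H) → Set where
    here : X u ≡ true → Reach X u u
    step : ∀ {w v} → Reach X u w → X v ≡ true → adj H w v ≡ true → Reach X u v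

  Connected : (Fin (size H) → Bool) → Set
  Connected X = Σ (Fin (size H)) (λ v → X v ≡ true)
              × (∀ u v → X u ≡ true → X v ≡ true → Reach X u v)

  IsChunk : (Fin (size H) → Bool) → Set
  IsChunk D = IsSlice D × Connected (int D)

  IsMuStar : ℕ → Set
  IsMuStar m = Σ (Fin (size H) → Bool) (λ D → IsChunk D × count (bnd D) ≡ m)
             × (∀ D → IsChunk D → count (bnd D) ≤ m)

  HasNonCliqueComponent : Set
  HasNonCliqueComponent =
    Σ (Fin (size H) → Bool) λ C →
      Connected C
      × (∀ u v → C u ≡ true → adj H u v ≡ true → C v ≡ true)
      × Σ (Fin (size H)) λ u → Σ (Fin (size H)) λ v →
          C u ≡ true × C v ≡ true × u ≢ v × adj H u v ≡ false

  record Slice (t : ℕ) : Set where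
    field
      D       : Fin (size H) → Bool
      isSlice : IsSlice D
      slab    : Fin (size H) → Fin t   -- only its values on ∂H[D] matter
      slab-inj : ∀ a b → bnd D a ≡ true → bnd D b ≡ true → slab a ≡ slab b → a ≡ b
  open Slice public

  -- A boundaried graph "inside" Fin n: vertex set V, edge relation E,
  -- boundary labelling lab (boundary = vertices with a label).
  Embeds : ∀ {t n} → Slice t → (Fin n → Bool) → (Fin n → Fin n → Bool)
         → (Fin n → Maybe (Fin t)) → Set
  Embeds {t} {n} s V E lab =
    Σ (Fin (size H) → Fin n) λ π →
      (∀ a b → D s a ≡ true → D s b ≡ true → π a ≡ π b → a ≡ b)
      × (∀ a → D s a ≡ true → V (π a) ≡ true)
      × (∀ a b → D s a ≡ true → D s b ≡ true → adj H a b ≡ true → E (π a) (π b) ≡ true)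
      × (∀ a → bnd (D s) a ≡ true → lab (π a) ≡ just (slab s a))

  InProfile : ∀ {t n} → ℕ → Slice t → (Fin n → Bool) → (Fin n → Fin n → Bool)
            → (Fin n → Maybe (Fin t)) → Set
  InProfile p s V E lab = count (D s) ≤ p × Embeds s V E lab

  delV : ∀ {n} → (Fin n → Bool) → (Fin n → Bool) → Fin n → Bool
  delV Y V v = V v ∧ not (Y v)

  delL : ∀ {t n} → (Fin n → Bool) → (Fin n → Maybe (Fin t)) → Fin n → Maybe (Fin t)
  delL Y lab v = if Y v then nothing else lab v

  -- (V₁,E₁,lab) is a witness-subgraph of (V₂,E₂,lab) (same boundary & labelling):
  -- every extended-profile component of the first is contained in that of the second.
  WitnessSub : ∀ {t n} → (lab : Fin n → Maybe (Fin t))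
             → (V₁ : Fin n → Bool) → (E₁ : Fin n → Fin n → Bool)
             → (V₂ : Fin n → Bool) → (E₂ : Fin n → Fin n → Bool) → Set
  WitnessSub {t} {n} lab V₁ E₁ V₂ E₂ =
    ∀ (Y : Fin n → Bool) → (∀ v → Y v ≡ true → is-just (lab v) ≡ true)
    → count Y ≤ size H
    → ∀ (s : Slice t)
    → InProfile (size H ∸ count Y) s (delV Y V₁) E₁ (delL Y lab)
    → InProfile (size H ∸ count Y) s (delV Y V₂) E₂ (delL Y lab)

record BGraph (t : ℕ) : Set where
  field
    gr      : Graph
    lab     : Fin (size gr) → Maybe (Fin t)   -- boundary = labelled vertices
    lab-inj : ∀ u v l → lab u ≡ just l → lab v ≡ just l → u ≡ v
open BGraph public

record SubGraph {t : ℕ} (G : BGraph t) : Set where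
  field
    S      : Fin (size (gr G)) → Bool
    E'     : Fin (size (gr G)) → Fin (size (gr G)) → Bool
    E'-sym : ∀ u v → E' u v ≡ E' v u
    E'⊆E   : ∀ u v → E' u v ≡ true → adj (gr G) u v ≡ true
    E'⊆S   : ∀ u v → E' u v ≡ true → S u ≡ true
open SubGraph public

-- For each set D ⊆ V(H) with |∂D| ≤ μ⋆ and each labelling of ∂D, keep a representative family of
-- the copies of H[D] in G: whenever some copy has interior avoiding a set of at most |V(H)|
-- vertices, a kept copy does too. Branching on the interior of one copy bounds each family by a
-- constant depending on H alone, and there are at most 2^|V(H)| (t+1)^μ⋆ families, so Ĝ, which
-- is ∂G with its edges plus the kept copies, has O((t+1)^μ⋆) vertices and edges. A non-clique
-- component yields a chunk with nonempty boundary, so μ⋆ ≥ 1 and the t boundary vertices fit too.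
-- Conversely, let π embed a slice into G − Y. Each component K of the slice's interior has a
-- chunk N[K] whose boundary lies on the slice boundary, hence is labelled and |∂N[K]| ≤ μ⋆.
-- Replacing π on K by a kept copy of N[K] with the same labels that avoids Y and the rest of
-- π's image keeps π an embedding; doing this for every component moves π into Ĝ.

module Submission where

open import Defs
open import Data.Bool using (Bool; true; false; _∧_; _∨_; not; if_then_else_)
open import Data.Bool.Properties using (∧-comm; ∧-identityʳ; ∧-zeroʳ; ∨-conicalˡ; not-injective)
open import Data.Empty using (⊥-elim)
open import Data.Fin using (Fin; zero; suc; _≟_)
import Data.Fin.Properties as Fin
open import Data.Fin.Properties using (all?)
open import Data.List using (List; []; _∷_; length; map; _++_; concatMap; filter; allFin; tabulate)
open import Data.Bool.ListAction using (any)
open import Data.List.Properties using (length-map; length-++; length-filter; length-tabulate; ∷-injectiveˡ; ∷-injectiveʳ)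
import Data.List.Properties as List
import Data.Maybe.Properties as Maybe
open import Data.Maybe using (Maybe; just; nothing; is-just)
open import Data.List.Membership.Propositional using (_∈_; find; lose)
open import Data.List.Membership.Propositional.Properties
  using (∈-map⁺; ∈-map⁻; ∈-++⁻; ∈-concatMap⁺; ∈-filter⁺; ∈-filter⁻; ∈-allFin)
open import Data.List.Relation.Unary.Any using (Any; here; there; any?)
import Data.List.Relation.Unary.All as All
import Data.Bool as Bool
open import Data.Nat using (ℕ; zero; suc; _+_; _*_; _∸_; _^_; _≤_; _<_; z≤n; s≤s; _≤?_)
open import Data.Nat.Properties
  using (≤-refl; ≤-reflexive; ≤-trans; ≤-antisym; ≤-pred; <⇒≤; <⇒≱; n≤1+n; module ≤-Reasoning;
         +-identityʳ; +-suc; +-mono-≤; +-monoˡ-≤; +-monoʳ-≤; m+[n∸m]≡n;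
         *-identityʳ; *-distribʳ-+; *-mono-≤; *-monoˡ-≤; *-monoʳ-≤; ^-monoˡ-≤; ^-monoʳ-≤)
open import Data.Product using (Σ; ∃; _×_; _,_; proj₁; proj₂)
open import Data.Sum using (_⊎_; inj₁; inj₂)
open import Function using (_∘_; id)
open import Data.Vec.Functional using (Vector) renaming ([] to []ᶠ; _∷_ to _∷ᶠ_)
open import Relation.Binary.Definitions using (DecidableEquality)
open import Relation.Binary.PropositionalEquality
open import Relation.Nullary using (¬_; ¬?; Dec; yes; no; does)
open import Relation.Nullary.Decidable using (dec-true; dec-false; _×-dec_; _→-dec_)
open import Relation.Unary using (Decidable)
open import Data.Nat.Tactic.RingSolver using (solve-∀)

private variable
  A B : Set
  k n : ℕ

≡true⇒≢false : ∀ {b} → b ≡ true → b ≢ false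
≡true⇒≢false refl ()

∧-intro : ∀ {a b} → a ≡ true → b ≡ true → a ∧ b ≡ true
∧-intro refl refl = refl

∧-elimˡ : ∀ {a b} → a ∧ b ≡ true → a ≡ true
∧-elimˡ {true} _ = refl

∧-elimʳ : ∀ {a b} → a ∧ b ≡ true → b ≡ true
∧-elimʳ {true} p = p

∨-introˡ : ∀ {a b} → a ≡ true → a ∨ b ≡ true
∨-introˡ refl = refl

∨-introʳ : ∀ {a b} → b ≡ true → a ∨ b ≡ true
∨-introʳ {true}  _ = refl
∨-introʳ {false} p = p

∨-elim : ∀ {a b} → a ∨ b ≡ true → a ≡ true ⊎ b ≡ true
∨-elim {true}  _ = inj₁ refl
∨-elim {false} p = inj₂ p

≡false⊎≡true : ∀ b → b ≡ false ⊎ b ≡ true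
≡false⊎≡true false = inj₁ refl
≡false⊎≡true true  = inj₂ refl

_==_ : Fin n → Fin n → Bool
a == b = does (a ≟ b)

==-refl : (a : Fin n) → (a == a) ≡ true
==-refl a = dec-true (a ≟ a) refl

does≡true⇒ : ∀ {P : Set} (p? : Dec P) → does p? ≡ true → P
does≡true⇒ (yes p) _ = p

==⇒≡ : {a b : Fin n} → (a == b) ≡ true → a ≡ b
==⇒≡ {a = a} {b} = does≡true⇒ (a ≟ b)

≢⇒==false : {a b : Fin n} → a ≢ b → (a == b) ≡ false
≢⇒==false {a = a} {b} = dec-false (a ≟ b)

anyF≡true⁺ : (f : Fin k → Bool) (a : Fin k) → f a ≡ true → anyF f ≡ true
anyF≡true⁺ f zero    p = ∨-introˡ p
anyF≡true⁺ f (suc a) p = ∨-introʳ {f zero} (anyF≡true⁺ (f ∘ suc) a p)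

anyF≡true⁻ : (f : Fin k → Bool) → anyF f ≡ true → ∃ λ a → f a ≡ true
anyF≡true⁻ {suc k} f p with ∨-elim {f zero} p
... | inj₁ q = zero , q
... | inj₂ q with a , r ← anyF≡true⁻ (f ∘ suc) q = suc a , r

anyF≡false : (f : Fin k → Bool) → (∀ a → f a ≡ false) → anyF f ≡ false
anyF≡false {zero}  f none = refl
anyF≡false {suc k} f none = cong₂ _∨_ (none zero) (anyF≡false (f ∘ suc) (none ∘ suc))

anyF-cong : {f g : Fin k → Bool} → (∀ a → f a ≡ g a) → anyF f ≡ anyF g
anyF-cong {zero}  e = refl
anyF-cong {suc k} e = cong₂ _∨_ (e zero) (anyF-cong (e ∘ suc))

any≡true⁺ : (p : A → Bool) {x : A} {xs : List A} → x ∈ xs → p x ≡ true → any p xs ≡ true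
any≡true⁺ p (here refl) px = ∨-introˡ px
any≡true⁺ p {xs = y ∷ _} (there x∈) px = ∨-introʳ {p y} (any≡true⁺ p x∈ px)

any≡true⁻ : (p : A → Bool) (xs : List A) → any p xs ≡ true → ∃ λ x → x ∈ xs × p x ≡ true
any≡true⁻ p (x ∷ xs) q with ∨-elim {p x} q
... | inj₁ px = x , here refl , px
... | inj₂ r with y , y∈ , py ← any≡true⁻ p xs r = y , there y∈ , py

+-interchange : ∀ a b c d → (a + b) + (c + d) ≡ (a + c) + (b + d)
+-interchange = solve-∀

indicator : Bool → ℕ
indicator b = if b then 1 else 0

sumF-cong : {f g : Fin k → ℕ} → (∀ a → f a ≡ g a) → sumF f ≡ sumF g
sumF-cong {zero}  e = refl
sumF-cong {suc k} e = cong₂ _+_ (e zero) (sumF-cong (e ∘ suc))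

sumF-mono-≤ : {f g : Fin k → ℕ} → (∀ a → f a ≤ g a) → sumF f ≤ sumF g
sumF-mono-≤ {zero}  e = z≤n
sumF-mono-≤ {suc k} e = +-mono-≤ (e zero) (sumF-mono-≤ (e ∘ suc))

sumF-+ : (f g : Fin k → ℕ) → sumF (λ a → f a + g a) ≡ sumF f + sumF g
sumF-+ {zero}  f g = refl
sumF-+ {suc k} f g =
  trans (cong (f zero + g zero +_) (sumF-+ (f ∘ suc) (g ∘ suc)))
        (+-interchange (f zero) (g zero) (sumF (f ∘ suc)) (sumF (g ∘ suc)))

sumF-*ʳ : (f : Fin k → ℕ) (c : ℕ) → sumF (λ a → f a * c) ≡ sumF f * c
sumF-*ʳ {zero}  f c = refl
sumF-*ʳ {suc k} f c = trans (cong (f zero * c +_) (sumF-*ʳ (f ∘ suc) c)) (sym (*-distribʳ-+ c (f zero) _))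

sumF-zero : (f : Fin k → ℕ) → (∀ a → f a ≡ 0) → sumF f ≡ 0
sumF-zero {zero}  f e = refl
sumF-zero {suc k} f e rewrite e zero = sumF-zero (f ∘ suc) (e ∘ suc)

sumF-≤-* : (f : Fin k → ℕ) (b : ℕ) → (∀ a → f a ≤ b) → sumF f ≤ k * b
sumF-≤-* {zero}  f b e = z≤n
sumF-≤-* {suc k} f b e = +-mono-≤ (e zero) (sumF-≤-* (f ∘ suc) b (e ∘ suc))

count-cong : {X Z : Fin n → Bool} → (∀ v → X v ≡ Z v) → count X ≡ count Z
count-cong e = sumF-cong (cong indicator ∘ e)

count-≤-size : (X : Fin n → Bool) → count X ≤ n
count-≤-size {n} X = subst (count X ≤_) (*-identityʳ n) (sumF-≤-* _ 1 (indicator≤1 ∘ X))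
  where
  indicator≤1 : ∀ b → indicator b ≤ 1
  indicator≤1 true  = ≤-refl
  indicator≤1 false = z≤n

indicator-mono : ∀ a b → (a ≡ true → b ≡ true) → indicator a ≤ indicator b
indicator-mono false b _ = z≤n
indicator-mono true  b p rewrite p refl = ≤-refl

count-mono : {X Z : Fin n → Bool} → (∀ v → X v ≡ true → Z v ≡ true) → count X ≤ count Z
count-mono {X = X} {Z} X⊆Z = sumF-mono-≤ (λ v → indicator-mono (X v) (Z v) (X⊆Z v))

count-∨ : (X Z : Fin n → Bool) → count (λ v → X v ∨ Z v) ≤ count X + count Z
count-∨ X Z = ≤-trans (sumF-mono-≤ (λ v → indicator-∨ (X v) (Z v)))
                      (≤-reflexive (sumF-+ (indicator ∘ X) (indicator ∘ Z)))
  where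
  indicator-∨ : ∀ a b → indicator (a ∨ b) ≤ indicator a + indicator b
  indicator-∨ true  b = s≤s z≤n
  indicator-∨ false b = ≤-refl

count-empty : (X : Fin n → Bool) → (∀ v → X v ≡ false) → count X ≡ 0
count-empty X e = sumF-zero _ (cong indicator ∘ e)

count-<-mono : {X Z : Fin n → Bool} → (∀ v → X v ≡ true → Z v ≡ true) →
               ∀ u → X u ≡ false → Z u ≡ true → count X < count Z
count-<-mono {X = X} {Z} X⊆Z zero Xu Zu rewrite Xu | Zu = s≤s (count-mono (X⊆Z ∘ suc))
count-<-mono {X = X} {Z} X⊆Z (suc u) Xu Zu =
  ≤-trans (≤-reflexive (sym (+-suc (indicator (X zero)) _)))
          (+-mono-≤ (indicator-mono (X zero) (Z zero) (X⊆Z zero)) (count-<-mono (X⊆Z ∘ suc) u Xu Zu))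

count-positive : (X : Fin n → Bool) (u : Fin n) → X u ≡ true → 1 ≤ count X
count-positive {n} X u Xu = subst (λ c → c < count X) (count-empty {n} (λ _ → false) (λ _ → refl))
                              (count-<-mono (λ _ ()) u refl Xu)

count-subsingleton : (X : Fin n → Bool) → (∀ u v → X u ≡ true → X v ≡ true → u ≡ v) → count X ≤ 1
count-subsingleton {zero}  X uniq = z≤n
count-subsingleton {suc n} X uniq with X zero in X0
... | true  = s≤s (≤-reflexive (count-empty (X ∘ suc) onlyZero))
  where
  onlyZero : ∀ v → X (suc v) ≡ false
  onlyZero v with X (suc v) in Xv
  ... | false = refl
  ... | true with () ← uniq zero (suc v) X0 Xv
... | false = count-subsingleton (X ∘ suc) (λ u v Xu Xv → Fin.suc-injective (uniq (suc u) (suc v) Xu Xv))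

count-singleton : (x : Fin n) → count (x ==_) ≤ 1
count-singleton x = count-subsingleton (x ==_) (λ u v p q → trans (sym (==⇒≡ {a = x} p)) (==⇒≡ {a = x} q))

count-anyF : (P : Fin k → Fin n → Bool) → count (λ v → anyF (λ a → P a v)) ≤ sumF (λ a → count (P a))
count-anyF {zero} {n} P = ≤-reflexive (count-empty {n} _ (λ v → refl))
count-anyF {suc k} P = ≤-trans (count-∨ (P zero) (λ v → anyF (λ a → P (suc a) v))) (+-monoʳ-≤ (count (P zero)) (count-anyF (P ∘ suc)))

count-any : (P : A → Fin n → Bool) (b : ℕ) (xs : List A) → (∀ x → x ∈ xs → count (P x) ≤ b) →
            count (λ v → any (λ x → P x v) xs) ≤ length xs * b
count-any {n = n} P b []       bound = ≤-reflexive (count-empty {n} _ (λ v → refl))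
count-any P b (x ∷ xs) bound = ≤-trans (count-∨ (P x) (λ v → any (λ y → P y v) xs))
  (+-mono-≤ (bound x (here refl)) (count-any P b xs (λ y y∈ → bound y (there y∈))))

count-∧ˡ : ∀ b (X : Fin n → Bool) → count (λ v → b ∧ X v) ≡ indicator b * count X
count-∧ˡ true  X = sym (+-identityʳ (count X))
count-∧ˡ {n} false X = count-empty {n} _ (λ v → refl)

countPairs-mono : {R Q : Fin n → Fin n → Bool} → (∀ u v → R u v ≡ true → Q u v ≡ true) → countPairs R ≤ countPairs Q
countPairs-mono R⊆Q = sumF-mono-≤ (λ u → count-mono (R⊆Q u))

countPairs-∨ : (R Q : Fin n → Fin n → Bool) → countPairs (λ u v → R u v ∨ Q u v) ≤ countPairs R + countPairs Q
countPairs-∨ R Q = ≤-trans (sumF-mono-≤ (λ u → count-∨ (R u) (Q u)))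
                           (≤-reflexive (sumF-+ (λ u → count (R u)) (λ u → count (Q u))))

countPairs-any : (P : A → Fin n → Fin n → Bool) (b : ℕ) (xs : List A) → (∀ x → x ∈ xs → countPairs (P x) ≤ b) →
                 countPairs (λ u v → any (λ x → P x u v) xs) ≤ length xs * b
countPairs-any {n = n} P b []       bound = ≤-reflexive (sumF-zero {n} _ (λ u → count-empty {n} _ (λ v → refl)))
countPairs-any P b (x ∷ xs) bound = ≤-trans (countPairs-∨ (P x) (λ u v → any (λ y → P y u v) xs))
  (+-mono-≤ (bound x (here refl)) (countPairs-any P b xs (λ y y∈ → bound y (there y∈))))

countPairs-∧ : (X Z : Fin n → Bool) → countPairs (λ u v → X u ∧ Z v) ≡ count X * count Z
countPairs-∧ X Z = trans (sumF-cong (λ u → count-∧ˡ (X u) Z)) (sumF-*ʳ (indicator ∘ X) (count Z))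

length-filter-tabulate : (X : Fin n → Bool) (f : Fin k → Fin n) →
                         length (filter (λ a → X a Bool.≟ true) (tabulate f)) ≡ sumF (λ i → indicator (X (f i)))
length-filter-tabulate {k = zero}  X f = refl
length-filter-tabulate {k = suc k} X f with X (f zero)
... | true  = cong suc (length-filter-tabulate X (f ∘ suc))
... | false = length-filter-tabulate X (f ∘ suc)

map-≡⇒≡ : {f g : A → B} (xs : List A) → map f xs ≡ map g xs → ∀ {x} → x ∈ xs → f x ≡ g x
map-≡⇒≡ (y ∷ xs) fxs≡gxs (here refl) = ∷-injectiveˡ fxs≡gxs
map-≡⇒≡ (y ∷ xs) fxs≡gxs (there x∈)  = map-≡⇒≡ xs (∷-injectiveʳ fxs≡gxs) x∈

∈-concatMap⁺′ : (f : A → List B) {x : A} {y : B} {xs : List A} → x ∈ xs → y ∈ f x → y ∈ concatMap f xs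
∈-concatMap⁺′ f x∈ y∈ = ∈-concatMap⁺ f (lose x∈ y∈)

length-concatMap-≤ : (f : A → List B) (b : ℕ) (xs : List A) → (∀ x → x ∈ xs → length (f x) ≤ b) →
                     length (concatMap f xs) ≤ length xs * b
length-concatMap-≤ f b []       bound = z≤n
length-concatMap-≤ f b (x ∷ xs) bound = ≤-trans (≤-reflexive (length-++ (f x)))
  (+-mono-≤ (bound x (here refl)) (length-concatMap-≤ f b xs (λ y y∈ → bound y (there y∈))))

functions : ∀ k → List A → List (Vector A k)
functions zero    xs = []ᶠ ∷ []
functions (suc k) xs = concatMap (λ x → map (x ∷ᶠ_) (functions k xs)) xs

length-functions : ∀ k (xs : List A) → length (functions k xs) ≤ length xs ^ k
length-functions zero    xs = ≤-refl
length-functions (suc k) xs = length-concatMap-≤ _ _ xs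
  (λ _ _ → ≤-trans (≤-reflexive (length-map _ (functions k xs))) (length-functions k xs))

functions-complete : ∀ k (xs : List A) (f : Vector A k) → (∀ i → f i ∈ xs) →
                     ∃ λ g → g ∈ functions k xs × (∀ i → g i ≡ f i)
functions-complete zero    xs f f∈ = []ᶠ , here refl , λ ()
functions-complete (suc k) xs f f∈ with g , g∈ , g≗ ← functions-complete k xs (f ∘ suc) (f∈ ∘ suc) =
  f zero ∷ᶠ g , ∈-concatMap⁺′ _ (f∈ zero) (∈-map⁺ (f zero ∷ᶠ_) g∈) , λ { zero → refl ; (suc i) → g≗ i }

tuples : ℕ → List A → List (List A)
tuples zero    xs = [] ∷ []
tuples (suc k) xs = concatMap (λ x → map (x ∷_) (tuples k xs)) xs

length-tuples : ∀ k (xs : List A) → length (tuples k xs) ≤ length xs ^ k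
length-tuples zero    xs = ≤-refl
length-tuples (suc k) xs = length-concatMap-≤ _ _ xs
  (λ _ _ → ≤-trans (≤-reflexive (length-map _ (tuples k xs))) (length-tuples k xs))

tuples-complete : (xs ys : List A) → (∀ y → y ∈ ys → y ∈ xs) → ys ∈ tuples (length ys) xs
tuples-complete xs []       ys⊆xs = here refl
tuples-complete xs (y ∷ ys) ys⊆xs = ∈-concatMap⁺′ _ (ys⊆xs y (here refl))
  (∈-map⁺ (y ∷_) (tuples-complete xs ys (λ z z∈ → ys⊆xs z (there z∈))))

Avoids : (Fin n → Bool) → List (Fin n) → Set
Avoids F xs = ¬ Any (λ v → F v ≡ true) xs

Avoids-intro : (F : Fin n → Bool) (xs : List (Fin n)) → (∀ v → v ∈ xs → F v ≡ false) → Avoids F xs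
Avoids-intro F xs avoid hit with v , v∈ , Fv ← find hit = ≡true⇒≢false Fv (avoid v v∈)

Avoids-elim : {F : Fin n → Bool} {xs : List (Fin n)} → Avoids F xs → ∀ {v} → v ∈ xs → F v ≡ false
Avoids-elim {F = F} avoid {v} v∈ with F v in Fv
... | false = refl
... | true  = ⊥-elim (avoid (lose v∈ Fv))

repBound : ℕ → ℕ → ℕ
repBound p zero    = 1
repBound p (suc q) = 1 + p * repBound p q

-- Monien's representative families: keep the first element, and for each vertex u of its image
-- (the set F must hit one of them if it hits that image) recurse on the elements missing u.
module Representatives {n : ℕ} (img : A → List (Fin n)) where
  open import Data.List.Membership.DecPropositional (_≟_ {n}) using (_∈?_)

  misses? : (u : Fin n) → Decidable (λ b → ¬ u ∈ img b)
  misses? u b = ¬? (u ∈? img b)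

  missing : Fin n → List A → List A
  missing u = filter (misses? u)

  representatives : ℕ → List A → List A
  representatives _       []      = []
  representatives zero    (a ∷ _) = a ∷ []
  representatives (suc q) (a ∷ L) = a ∷ concatMap (λ u → representatives q (missing u (a ∷ L))) (img a)

  representatives-⊆ : ∀ q L {b} → b ∈ representatives q L → b ∈ L
  representatives-⊆ zero    (a ∷ L) (here refl) = here refl
  representatives-⊆ (suc q) (a ∷ L) (here refl) = here refl
  representatives-⊆ (suc q) (a ∷ L) (there b∈) = viaBranch (img a) b∈
    where
    viaBranch : ∀ us {b} → b ∈ concatMap (λ u → representatives q (missing u (a ∷ L))) us → b ∈ a ∷ L
    viaBranch (u ∷ us) b∈ with ∈-++⁻ (representatives q (missing u (a ∷ L))) b∈
    ... | inj₁ b∈u  = proj₁ (∈-filter⁻ (misses? u) (representatives-⊆ q _ b∈u))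
    ... | inj₂ b∈us = viaBranch us b∈us

  length-representatives : ∀ {p} → (∀ a → length (img a) ≤ p) → ∀ q L → length (representatives q L) ≤ repBound p q
  length-representatives bound zero    []      = z≤n
  length-representatives bound zero    (a ∷ L) = ≤-refl
  length-representatives bound (suc q) []      = z≤n
  length-representatives {p} bound (suc q) (a ∷ L) = s≤s (≤-trans
    (length-concatMap-≤ _ (repBound p q) (img a) (λ u _ → length-representatives bound q (missing u (a ∷ L))))
    (*-monoˡ-≤ (repBound p q) (bound a)))

  representatives-avoid : ∀ q L (F : Fin n → Bool) → count F ≤ q → ∀ {a} → a ∈ L → Avoids F (img a) →
                          ∃ λ b → b ∈ representatives q L × Avoids F (img b)
  representatives-avoid zero (a₀ ∷ L) F |F|≤0 _ _ = a₀ , here refl , Avoids-intro F (img a₀) (λ v _ → F≡∅ v)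
    where
    F≡∅ : ∀ v → F v ≡ false
    F≡∅ v with F v in Fv
    ... | false = refl
    ... | true with () ← ≤-trans (count-positive F v Fv) |F|≤0
  representatives-avoid (suc q) (a₀ ∷ L) F |F|≤q+1 {a} a∈ a-avoids
    with any? (λ v → F v Bool.≟ true) (img a₀)
  ... | no a₀-avoids = a₀ , here refl , a₀-avoids
  ... | yes hit with u , u∈a₀ , Fu ← find hit = branch
    where
    F′ : Fin n → Bool
    F′ v = F v ∧ not (u == v)
    |F′|≤q : count F′ ≤ q
    |F′|≤q = ≤-pred (≤-trans (count-<-mono {X = F′} {F} (λ v → ∧-elimˡ) u F′u Fu) |F|≤q+1)
      where
      F′u : F′ u ≡ false
      F′u = trans (cong (λ c → F u ∧ not c) (==-refl u)) (∧-zeroʳ (F u))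
    u∉a : ¬ u ∈ img a
    u∉a u∈a = ≡true⇒≢false Fu (Avoids-elim a-avoids u∈a)
    a-avoids′ : Avoids F′ (img a)
    a-avoids′ = Avoids-intro F′ (img a) (λ v v∈ → cong (_∧ _) (Avoids-elim a-avoids v∈))
    branch : ∃ λ b → b ∈ representatives (suc q) (a₀ ∷ L) × Avoids F (img b)
    branch with b , b∈ , b-avoids ← representatives-avoid q (missing u (a₀ ∷ L)) F′ |F′|≤q (∈-filter⁺ (misses? u) a∈ u∉a) a-avoids′
      = b , there (∈-concatMap⁺′ _ u∈a₀ b∈) , Avoids-intro F (img b) b-avoidsF
      where
      u∉b : ¬ u ∈ img b
      u∉b = proj₂ (∈-filter⁻ (misses? u) (representatives-⊆ q _ b∈))
      b-avoidsF : ∀ v → v ∈ img b → F v ≡ false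
      b-avoidsF v v∈ with u ≟ v
      ... | yes refl = ⊥-elim (u∉b v∈)
      ... | no u≢v = trans (sym (∧-identityʳ (F v))) (subst (λ c → F v ∧ not c ≡ false) (≢⇒==false {a = u} u≢v) (Avoids-elim b-avoids v∈))

module _ {H : Graph} {X : Fin (size H) → Bool} where

  reach-target : ∀ {u v} → Reach H X u v → X v ≡ true
  reach-target (here Xv)     = Xv
  reach-target (step _ Xv _) = Xv

  reach-trans : ∀ {u w v} → Reach H X u w → Reach H X w v → Reach H X u v
  reach-trans r (here _)      = r
  reach-trans r (step q Xv e) = step (reach-trans r q) Xv e

  reach-sym : ∀ {u v} → Reach H X u v → Reach H X v u
  reach-sym (here Xu) = here Xu
  reach-sym {v = v} (step {w} r Xv e) =
    reach-trans (step (here Xv) (reach-target r) (trans (adj-sym H v w) e)) (reach-sym r)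

reach-mono : ∀ {H X Z u v} → (∀ w → X w ≡ true → Z w ≡ true) → Reach H X u v → Reach H Z u v
reach-mono X⊆Z (here Xu)     = here (X⊆Z _ Xu)
reach-mono X⊆Z (step r Xv e) = step (reach-mono X⊆Z r) (X⊆Z _ Xv) e

module Chunks (H : Graph) where

  private
    V = Fin (size H)
    _~_ : V → V → Bool
    _~_ = adj H

  ~-sym : ∀ {a b} → a ~ b ≡ true → b ~ a ≡ true
  ~-sym {a} {b} = trans (adj-sym H b a)

  bnd-intro : ∀ D {y} z → D y ≡ true → D z ≡ false → z ~ y ≡ true → bnd H D y ≡ true
  bnd-intro D {y} z Dy Dz z~y rewrite Dy = anyF≡true⁺ (λ u → not (D u) ∧ u ~ y) z (∧-intro (cong not Dz) z~y)

  bnd⊆ : ∀ D {y} → bnd H D y ≡ true → D y ≡ true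
  bnd⊆ D {y} p with D y
  ... | true = refl

  ∉⇒∉bnd : ∀ D {y} → D y ≡ false → bnd H D y ≡ false
  ∉⇒∉bnd D {y} Dy = cong (λ c → not (not c) ∧ anyF (λ u → not (D u) ∧ u ~ y)) Dy

  bnd-witness : ∀ D {y} → bnd H D y ≡ true → ∃ λ z → D z ≡ false × z ~ y ≡ true
  bnd-witness D {y} p with z , q ← anyF≡true⁻ (λ u → not (D u) ∧ u ~ y) (∧-elimʳ {not (not (D y))} p) =
    z , not-injective (∧-elimˡ q) , ∧-elimʳ q

  bnd≡false : ∀ D {y} → (∀ z → z ~ y ≡ true → D z ≡ true) → bnd H D y ≡ false
  bnd≡false D {y} nbrs⊆D with bnd H D y in b
  ... | false = refl
  ... | true with z , Dz , z~y ← bnd-witness D b = ⊥-elim (≡true⇒≢false (nbrs⊆D z z~y) Dz)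

  int-intro : ∀ D {y} → D y ≡ true → bnd H D y ≡ false → int H D y ≡ true
  int-intro D Dy b rewrite Dy | b = refl

  int⊆ : ∀ D {y} → int H D y ≡ true → D y ≡ true
  int⊆ D = ∧-elimˡ

  int⇒∉bnd : ∀ D {y} → int H D y ≡ true → bnd H D y ≡ false
  int⇒∉bnd D p = not-injective (∧-elimʳ p)

  bnd⇒∉int : ∀ D {y} → bnd H D y ≡ true → int H D y ≡ false
  bnd⇒∉int D {y} b = trans (cong (λ c → D y ∧ not c) b) (∧-zeroʳ (D y))

  ∖int⇒bnd : ∀ D {y} → D y ≡ true → int H D y ≡ false → bnd H D y ≡ true
  ∖int⇒bnd D {y} Dy ¬int with ≡false⊎≡true (bnd H D y)
  ... | inj₂ b = b
  ... | inj₁ b = ⊥-elim (≡true⇒≢false (int-intro D Dy b) ¬int)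

  int-neighbour : ∀ D {y w} → int H D y ≡ true → y ~ w ≡ true → D w ≡ true
  int-neighbour D {y} {w} p y~w with D w in Dw
  ... | true  = refl
  ... | false = ⊥-elim (≡true⇒≢false (bnd-intro D w (int⊆ D p) Dw (~-sym y~w)) (int⇒∉bnd D p))

  bnd-cong : ∀ {D D′} → (∀ v → D v ≡ D′ v) → ∀ y → bnd H D y ≡ bnd H D′ y
  bnd-cong {D} {D′} e y = cong₂ (λ a b → not (not a) ∧ b) (e y) (anyF-cong (λ u → cong (λ c → not c ∧ u ~ y) (e u)))

  int-cong : ∀ {D D′} → (∀ v → D v ≡ D′ v) → ∀ y → int H D y ≡ int H D′ y
  int-cong e y = cong₂ (λ a b → a ∧ not b) (e y) (bnd-cong e y)

  record Component (X : V → Bool) (x : V) : Set where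
    field
      K        : V → Bool
      x∈K      : K x ≡ true
      K⊆X      : ∀ y → K y ≡ true → X y ≡ true
      K-closed : ∀ y z → K y ≡ true → X z ≡ true → y ~ z ≡ true → K z ≡ true
      K-reach  : ∀ y → K y ≡ true → Reach H K x y

  frontier : (X K : V → Bool) → V → Bool
  frontier X K z = X z ∧ not (K z) ∧ anyF (λ y → K y ∧ y ~ z)

  -- Adds frontier vertices one at a time; K cannot outgrow V, so the fuel never runs out.
  grow : ∀ X x fuel (K : V → Bool) → K x ≡ true → (∀ y → K y ≡ true → X y ≡ true) →
         (∀ y → K y ≡ true → Reach H K x y) → size H < count K + fuel → Component X x
  grow X x fuel K x∈K K⊆X K-reach room with anyF (frontier X K) in someFrontier
  ... | false = record { K = K ; x∈K = x∈K ; K⊆X = K⊆X ; K-closed = closed ; K-reach = K-reach }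
    where
    closed : ∀ y z → K y ≡ true → X z ≡ true → y ~ z ≡ true → K z ≡ true
    closed y z Ky Xz y~z with K z in Kz
    ... | true  = refl
    ... | false = ⊥-elim (≡true⇒≢false (anyF≡true⁺ _ z
                    (∧-intro Xz (∧-intro (cong not Kz) (anyF≡true⁺ (λ y → K y ∧ y ~ z) y (∧-intro Ky y~z))))) someFrontier)
  ... | true with z , z∈frontier ← anyF≡true⁻ _ someFrontier = next fuel room
    where
    Xz : X z ≡ true
    Xz = ∧-elimˡ z∈frontier
    Kz : K z ≡ false
    Kz = not-injective (∧-elimˡ (∧-elimʳ {X z} z∈frontier))
    y,y~z : ∃ λ y → (K y ∧ y ~ z) ≡ true
    y,y~z = anyF≡true⁻ (λ y → K y ∧ y ~ z) (∧-elimʳ (∧-elimʳ {X z} z∈frontier))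
    K′ : V → Bool
    K′ v = K v ∨ (z == v)
    z∈K′ : K′ z ≡ true
    z∈K′ = ∨-introʳ {K z} (==-refl z)
    K⊆K′ : ∀ v → K v ≡ true → K′ v ≡ true
    K⊆K′ v = ∨-introˡ
    grew : count K < count K′
    grew = count-<-mono {X = K} {K′} K⊆K′ z Kz z∈K′
    K′⊆X : ∀ y → K′ y ≡ true → X y ≡ true
    K′⊆X y p with ∨-elim {K y} p
    ... | inj₁ Ky = K⊆X y Ky
    ... | inj₂ z=y with refl ← ==⇒≡ {a = z} z=y = Xz
    K′-reach : ∀ y → K′ y ≡ true → Reach H K′ x y
    K′-reach y p with ∨-elim {K y} p
    ... | inj₁ Ky = reach-mono K⊆K′ (K-reach y Ky)
    ... | inj₂ z=y with refl ← ==⇒≡ {a = z} z=y =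
      step (reach-mono K⊆K′ (K-reach (proj₁ y,y~z) (∧-elimˡ (proj₂ y,y~z)))) z∈K′ (∧-elimʳ (proj₂ y,y~z))
    next : ∀ f → size H < count K + f → Component X x
    next zero    room′ = ⊥-elim (<⇒≱ (≤-trans room′ (≤-trans (≤-reflexive (+-identityʳ (count K))) (<⇒≤ grew)))
                                      (count-≤-size K′))
    next (suc f) room′ = grow X x f K′ (K⊆K′ x x∈K) K′⊆X K′-reach
                           (≤-trans room′ (≤-trans (≤-reflexive (+-suc (count K) f)) (+-monoˡ-≤ f grew)))

  opaque
    component : ∀ X x → X x ≡ true → Component X x
    component X x Xx = grow X x (size H) (x ==_) (==-refl x) singleton⊆X singleton-reach room
      where
      singleton⊆X : ∀ y → (x == y) ≡ true → X y ≡ true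
      singleton⊆X y p with refl ← ==⇒≡ {a = x} p = Xx
      singleton-reach : ∀ y → (x == y) ≡ true → Reach H (x ==_) x y
      singleton-reach y p with refl ← ==⇒≡ {a = x} p = here (==-refl x)
      room : size H < count (x ==_) + size H
      room = subst (λ c → size H < c + size H) (sym (≤-antisym (count-singleton x) (count-positive _ x (==-refl x)))) ≤-refl

  module ComponentChunk (D : V → Bool) {x : V} (x∈int : int H D x ≡ true) where
    open Component (component (int H D) x x∈int) public

    N[K] : V → Bool
    N[K] y = K y ∨ anyF (λ w → K w ∧ w ~ y)

    K⊆N[K] : ∀ y → K y ≡ true → N[K] y ≡ true
    K⊆N[K] y = ∨-introˡ

    neighbour∈N[K] : ∀ y w → K y ≡ true → y ~ w ≡ true → N[K] w ≡ true
    neighbour∈N[K] y w Ky y~w = ∨-introʳ {K w} (anyF≡true⁺ (λ u → K u ∧ u ~ w) y (∧-intro Ky y~w))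

    N[K]⊆D : ∀ y → N[K] y ≡ true → D y ≡ true
    N[K]⊆D y p with ∨-elim {K y} p
    ... | inj₁ Ky = int⊆ D (K⊆X y Ky)
    ... | inj₂ q with w , r ← anyF≡true⁻ (λ w → K w ∧ w ~ y) q = int-neighbour D (K⊆X w (∧-elimˡ r)) (∧-elimʳ r)

    -- K is a whole component of H[int D], so its other neighbours lie outside int D.
    N[K]∖K⊆bnd : ∀ y → N[K] y ≡ true → K y ≡ false → bnd H D y ≡ true
    N[K]∖K⊆bnd y p Ky with ∨-elim {K y} p
    ... | inj₁ Ky′ = ⊥-elim (≡true⇒≢false Ky′ Ky)
    ... | inj₂ q with w , r ← anyF≡true⁻ (λ w → K w ∧ w ~ y) q with ≡false⊎≡true (int H D y)
    ... | inj₁ ¬int = ∖int⇒bnd D (N[K]⊆D y p) ¬int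
    ... | inj₂ int = ⊥-elim (≡true⇒≢false (K-closed w y (∧-elimˡ r) int (∧-elimʳ r)) Ky)

    bnd⇒∉K : ∀ y → bnd H D y ≡ true → K y ≡ false
    bnd⇒∉K y b with K y in Ky
    ... | false = refl
    ... | true  = ⊥-elim (≡true⇒≢false (K⊆X y Ky) (bnd⇒∉int D b))

    bnd-N[K]-intro : ∀ y → N[K] y ≡ true → K y ≡ false → bnd H N[K] y ≡ true
    bnd-N[K]-intro y p Ky with z , Dz , z~y ← bnd-witness D (N[K]∖K⊆bnd y p Ky) = bnd-intro N[K] z p z∉N[K] z~y
      where
      z∉N[K] : N[K] z ≡ false
      z∉N[K] with N[K] z in N[K]z
      ... | false = refl
      ... | true  = ⊥-elim (≡true⇒≢false (N[K]⊆D z N[K]z) Dz)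

    K⇒∉bnd-N[K] : ∀ y → K y ≡ true → bnd H N[K] y ≡ false
    K⇒∉bnd-N[K] y Ky = bnd≡false N[K] (λ z z~y → neighbour∈N[K] y z Ky (~-sym z~y))

    bnd-N[K] : ∀ y → bnd H N[K] y ≡ not (K y) ∧ anyF (λ w → K w ∧ w ~ y)
    bnd-N[K] y with ≡false⊎≡true (K y)
    ... | inj₂ Ky = trans (K⇒∉bnd-N[K] y Ky) (cong (λ c → not c ∧ anyF (λ w → K w ∧ w ~ y)) (sym Ky))
    ... | inj₁ Ky with ≡false⊎≡true (anyF (λ w → K w ∧ w ~ y))
    ...   | inj₂ Ny = trans (bnd-N[K]-intro y (∨-introʳ {K y} Ny) Ky) (cong₂ (λ a b → not a ∧ b) (sym Ky) (sym Ny))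
    ...   | inj₁ Ny = trans (∉⇒∉bnd N[K] (cong₂ _∨_ Ky Ny)) (cong₂ (λ a b → not a ∧ b) (sym Ky) (sym Ny))

    int-N[K] : ∀ y → int H N[K] y ≡ K y
    int-N[K] y with ≡false⊎≡true (K y)
    ... | inj₂ Ky = trans (int-intro N[K] (K⊆N[K] y Ky) (K⇒∉bnd-N[K] y Ky)) (sym Ky)
    ... | inj₁ Ky with ≡false⊎≡true (N[K] y)
    ...   | inj₁ ∉N[K] = trans (cong (_∧ not (bnd H N[K] y)) ∉N[K]) (sym Ky)
    ...   | inj₂ ∈N[K] = trans (bnd⇒∉int N[K] (bnd-N[K]-intro y ∈N[K] Ky)) (sym Ky)

    N[K]-isChunk : IsChunk H N[K]
    N[K]-isChunk = N[K]-isSlice , (x , K⊆int x x∈K) , int-connected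
      where
      N[K]-isSlice : IsSlice H N[K]
      N[K]-isSlice v = trans (cong₂ (λ a b → not a ∧ b) (int-N[K] v) (anyF-cong (λ u → cong (_∧ u ~ v) (int-N[K] u))))
                             (sym (bnd-N[K] v))
      K⊆int : ∀ y → K y ≡ true → int H N[K] y ≡ true
      K⊆int y Ky = trans (int-N[K] y) Ky
      int⊆K : ∀ {y} → int H N[K] y ≡ true → K y ≡ true
      int⊆K {y} p = trans (sym (int-N[K] y)) p
      int-connected : ∀ u v → int H N[K] u ≡ true → int H N[K] v ≡ true → Reach H (int H N[K]) u v
      int-connected u v p q = reach-mono K⊆int (reach-trans (reach-sym (K-reach u (int⊆K p))) (K-reach v (int⊆K q)))

    bnd-N[K]⊆bnd : ∀ y → bnd H N[K] y ≡ true → bnd H D y ≡ true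
    bnd-N[K]⊆bnd y b = N[K]∖K⊆bnd y (bnd⊆ N[K] b) (not-injective (∧-elimˡ (trans (sym (bnd-N[K] y)) b)))

    neighbour∉K⇒bnd-N[K] : ∀ a b → K a ≡ true → a ~ b ≡ true → K b ≡ false → bnd H N[K] b ≡ true
    neighbour∉K⇒bnd-N[K] a b Ka a~b Kb = bnd-N[K]-intro b (neighbour∈N[K] a b Ka a~b) Kb

  InducedP₃ : Set
  InducedP₃ = ∃ λ x → ∃ λ y → ∃ λ z → x ~ y ≡ true × y ~ z ≡ true × x ~ z ≡ false × x ≢ z

  walk-trichotomy : ∀ {X u w} → Reach H X u w → w ≡ u ⊎ u ~ w ≡ true ⊎ InducedP₃
  walk-trichotomy (here _) = inj₁ refl
  walk-trichotomy {u = u} (step {w′} {w} r _ w′~w) with walk-trichotomy r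
  ... | inj₁ refl         = inj₂ (inj₁ w′~w)
  ... | inj₂ (inj₂ p₃)    = inj₂ (inj₂ p₃)
  ... | inj₂ (inj₁ u~w′) with u ~ w in u~w | u ≟ w
  ...   | true  | _       = inj₂ (inj₁ refl)
  ...   | false | yes u≡w = inj₁ (sym u≡w)
  ...   | false | no u≢w  = inj₂ (inj₂ (u , w′ , w , u~w′ , w′~w , u~w , u≢w))

  nonClique⇒InducedP₃ : HasNonCliqueComponent H → InducedP₃
  nonClique⇒InducedP₃ (C , (_ , C-conn) , _ , u , v , Cu , Cv , u≢v , u≁v) with walk-trichotomy (C-conn u v Cu Cv)
  ... | inj₁ v≡u        = ⊥-elim (u≢v (sym v≡u))
  ... | inj₂ (inj₁ u~v) = ⊥-elim (≡true⇒≢false u~v u≁v)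
  ... | inj₂ (inj₂ p₃)  = p₃

  -- With x – y – z induced, take the chunk around the component of x in int N[x]; y is on its boundary.
  InducedP₃⇒chunk-with-boundary : InducedP₃ → ∃ λ D → IsChunk H D × 1 ≤ count (bnd H D)
  InducedP₃⇒chunk-with-boundary (x , y , z , x~y , y~z , x≁z , x≢z) =
    N[K] , N[K]-isChunk , count-positive (bnd H N[K]) y (neighbour∉K⇒bnd-N[K] x y x∈K x~y y∉K)
    where
    N[x] : V → Bool
    N[x] v = (x == v) ∨ x ~ v
    x∈int : int H N[x] x ≡ true
    x∈int = int-intro N[x] (∨-introˡ (==-refl x)) (bnd≡false N[x] (λ w w~x → ∨-introʳ {x == w} (~-sym w~x)))
    open ComponentChunk N[x] x∈int
    y∉K : K y ≡ false
    y∉K = bnd⇒∉K y (bnd-intro N[x] z (∨-introʳ {x == y} x~y) (cong₂ _∨_ (≢⇒==false x≢z) x≁z) (~-sym y~z))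

  μ⋆-positive : ∀ {m} → HasNonCliqueComponent H → IsMuStar H m → 1 ≤ m
  μ⋆-positive nonClique (_ , μ⋆-max) = ≤-trans (proj₂ (proj₂ chunk)) (μ⋆-max (proj₁ chunk) (proj₁ (proj₂ chunk)))
    where
    chunk : ∃ λ D → IsChunk H D × 1 ≤ count (bnd H D)
    chunk = InducedP₃⇒chunk-with-boundary (nonClique⇒InducedP₃ nonClique)

sizeConstant : ℕ → ℕ
sizeConstant h = 1 + 2 ^ h * repBound h h * h + 2 ^ h * repBound h h * (h * h)

module Sparsifier (H : Graph) (m : ℕ) {t : ℕ} (G : BGraph t) where
  open Chunks H

  private
    h : ℕ
    h = size H
    V W : Set
    V = Fin h
    W = Fin (size (gr G))
    _~_ : V → V → Bool
    _~_ = adj H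
    _~ᴳ_ : W → W → Bool
    _~ᴳ_ = adj (gr G)
    L : W → Maybe (Fin t)
    L = lab G
    _≟ₘ_ : DecidableEquality (Maybe (Fin t))
    _≟ₘ_ = Maybe.≡-dec _≟_

  onBoundary : W → Bool
  onBoundary v = is-just (L v)

  InjectiveOn : (V → Bool) → (V → W) → Set
  InjectiveOn D π = ∀ a b → D a ≡ true → D b ≡ true → π a ≡ π b → a ≡ b

  HomomorphicOn : (V → Bool) → (V → W) → Set
  HomomorphicOn D π = ∀ a b → D a ≡ true → D b ≡ true → a ~ b ≡ true → π a ~ᴳ π b ≡ true

  inBoundary? : ∀ D → Decidable (λ a → bnd H D a ≡ true)
  inBoundary? D a = bnd H D a Bool.≟ true

  inInterior? : ∀ D → Decidable (λ a → int H D a ≡ true)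
  inInterior? D a = int H D a Bool.≟ true

  boundaryOf : (V → Bool) → List V
  boundaryOf D = filter (inBoundary? D) (allFin h)

  interiorOf : (V → Bool) → List V
  interiorOf D = filter (inInterior? D) (allFin h)

  IsCopy : (V → Bool) → List (Fin t) → (V → W) → Set
  IsCopy D ℓs π = InjectiveOn D π × HomomorphicOn D π × map (L ∘ π) (boundaryOf D) ≡ map just ℓs

  isCopy? : ∀ D ℓs → Decidable (IsCopy D ℓs)
  isCopy? D ℓs π = injective? ×-dec homomorphic? ×-dec List.≡-dec _≟ₘ_ _ _
    where
    injective? : Dec (InjectiveOn D π)
    injective? = all? λ a → all? λ b → (D a Bool.≟ true) →-dec (D b Bool.≟ true) →-dec (π a ≟ π b) →-dec (a ≟ b)
    homomorphic? : Dec (HomomorphicOn D π)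
    homomorphic? = all? λ a → all? λ b → (D a Bool.≟ true) →-dec (D b Bool.≟ true) →-dec (a ~ b Bool.≟ true) →-dec (π a ~ᴳ π b Bool.≟ true)

  copies : (V → Bool) → List (Fin t) → List (V → W)
  copies D ℓs = filter (isCopy? D ℓs) (functions h (allFin (size (gr G))))

  record ChunkCopy : Set where
    constructor _↦_
    field
      dom  : V → Bool
      copy : V → W
  open ChunkCopy public

  image : ChunkCopy → W → Bool
  image c v = anyF (λ a → dom c a ∧ (copy c a == v))

  interiorImage : (V → Bool) → (V → W) → List W
  interiorImage D π = map π (interiorOf D)

  open Representatives

  smallBoundary? : Decidable (λ D → count (bnd H D) ≤ m)
  smallBoundary? D = count (bnd H D) ≤? m

  smallBoundarySets : List (V → Bool)
  smallBoundarySets = filter smallBoundary? (functions h (true ∷ false ∷ []))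

  labelPatterns : (V → Bool) → List (List (Fin t))
  labelPatterns D = tuples (length (boundaryOf D)) (allFin t)

  -- Avoiding sets of size h suffices: a deleted set Y plus the rest of a slice has at most h vertices.
  representativeCopies : (V → Bool) → List (Fin t) → List (V → W)
  representativeCopies D ℓs = representatives (interiorImage D) h (copies D ℓs)

  length-interiorImage : ∀ D π → length (interiorImage D π) ≤ h
  length-interiorImage D π = begin
    length (interiorImage D π) ≡⟨ length-map π (interiorOf D) ⟩
    length (interiorOf D)      ≤⟨ length-filter (inInterior? D) (allFin h) ⟩
    length (allFin h)          ≡⟨ length-tabulate id ⟩
    h                          ∎
    where open ≤-Reasoning

  length-boundaryOf : ∀ D → length (boundaryOf D) ≡ count (bnd H D)
  length-boundaryOf D = length-filter-tabulate (bnd H D) id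

  opaque
    family : List ChunkCopy
    family = concatMap (λ D → concatMap (λ ℓs → map (D ↦_) (representativeCopies D ℓs)) (labelPatterns D)) smallBoundarySets

    ∈family : ∀ {D ℓs ρ} → D ∈ smallBoundarySets → ℓs ∈ labelPatterns D → ρ ∈ representativeCopies D ℓs → (D ↦ ρ) ∈ family
    ∈family D∈ ℓs∈ ρ∈ = ∈-concatMap⁺′ _ D∈ (∈-concatMap⁺′ _ ℓs∈ (∈-map⁺ (_ ↦_) ρ∈))

    length-family : length family ≤ 2 ^ h * (suc t ^ m * repBound h h)
    length-family = ≤-trans (length-concatMap-≤ _ (suc t ^ m * repBound h h) smallBoundarySets perSet)
                            (*-monoˡ-≤ _ (≤-trans (length-filter smallBoundary? (functions h (true ∷ false ∷ []))) (length-functions h (true ∷ false ∷ []))))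
      where
      perSet : ∀ D → D ∈ smallBoundarySets →
               length (concatMap (λ ℓs → map (D ↦_) (representativeCopies D ℓs)) (labelPatterns D)) ≤ suc t ^ m * repBound h h
      perSet D D∈ = ≤-trans (length-concatMap-≤ _ (repBound h h) (labelPatterns D) perPattern) (*-monoˡ-≤ (repBound h h) patterns≤)
        where
        perPattern : ∀ ℓs → ℓs ∈ labelPatterns D → length (map (D ↦_) (representativeCopies D ℓs)) ≤ repBound h h
        perPattern ℓs _ = ≤-trans (≤-reflexive (length-map _ (representativeCopies D ℓs)))
                                  (length-representatives (interiorImage D) (length-interiorImage D) h (copies D ℓs))
        |∂D|≤m : length (boundaryOf D) ≤ m
        |∂D|≤m = subst (_≤ m) (sym (length-boundaryOf D)) (proj₂ (∈-filter⁻ smallBoundary? {xs = functions h (true ∷ false ∷ [])} D∈))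
        patterns≤ : length (labelPatterns D) ≤ suc t ^ m
        patterns≤ = begin
          length (labelPatterns D)          ≤⟨ length-tuples (length (boundaryOf D)) (allFin t) ⟩
          length (allFin t) ^ length (boundaryOf D) ≡⟨ cong (_^ length (boundaryOf D)) (length-tabulate id) ⟩
          t ^ length (boundaryOf D)         ≤⟨ ^-monoˡ-≤ (length (boundaryOf D)) (n≤1+n t) ⟩
          suc t ^ length (boundaryOf D)     ≤⟨ ^-monoʳ-≤ (suc t) |∂D|≤m ⟩
          suc t ^ m                         ∎
          where open ≤-Reasoning

  keptVertex : W → Bool
  keptVertex v = onBoundary v ∨ any (λ c → image c v) family

  keptEdge : W → W → Bool
  keptEdge u v = u ~ᴳ v ∧ ((onBoundary u ∧ onBoundary v) ∨ any (λ c → image c u ∧ image c v) family)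

  Ĝ : SubGraph G
  Ĝ = record
    { S      = keptVertex
    ; E'     = keptEdge
    ; E'-sym = λ u v → cong₂ _∧_ (adj-sym (gr G) u v)
                         (cong₂ _∨_ (∧-comm (onBoundary u) _) (any-cong family (λ c → ∧-comm (image c u) _)))
    ; E'⊆E   = λ u v → ∧-elimˡ
    ; E'⊆S   = keptEdge⇒keptVertex
    }
    where
    any-cong : ∀ {p q : ChunkCopy → Bool} xs → (∀ x → p x ≡ q x) → any p xs ≡ any q xs
    any-cong []       e = refl
    any-cong (x ∷ xs) e = cong₂ _∨_ (e x) (any-cong xs e)
    keptEdge⇒keptVertex : ∀ u v → keptEdge u v ≡ true → keptVertex u ≡ true
    keptEdge⇒keptVertex u v p with ∨-elim {onBoundary u ∧ onBoundary v} (∧-elimʳ {u ~ᴳ v} p)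
    ... | inj₁ q = ∨-introˡ (∧-elimˡ {onBoundary u} q)
    ... | inj₂ q with c , c∈ , uv∈c ← any≡true⁻ _ family q = ∨-introʳ {onBoundary u} (any≡true⁺ (λ c → image c u) c∈ (∧-elimˡ uv∈c))

  count-onBoundary : count onBoundary ≤ t
  count-onBoundary = begin
    count onBoundary                          ≤⟨ count-mono {X = onBoundary} {λ v → anyF (λ l → labelled l v)} onBoundary⇒labelled ⟩
    count (λ v → anyF (λ l → labelled l v))   ≤⟨ count-anyF labelled ⟩
    sumF (λ l → count (labelled l))           ≤⟨ sumF-≤-* _ 1 (λ l → count-subsingleton (labelled l) (labelled-unique l)) ⟩
    t * 1                                     ≡⟨ *-identityʳ t ⟩
    t                                         ∎
    where
    open ≤-Reasoning
    labelled : Fin t → W → Bool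
    labelled l v = does (L v ≟ₘ just l)
    labelled-unique : ∀ l u v → labelled l u ≡ true → labelled l v ≡ true → u ≡ v
    labelled-unique l u v p q = lab-inj G u v l (does≡true⇒ (L u ≟ₘ just l) p) (does≡true⇒ (L v ≟ₘ just l) q)
    onBoundary⇒labelled : ∀ v → onBoundary v ≡ true → anyF (λ l → labelled l v) ≡ true
    onBoundary⇒labelled v p with L v in Lv
    ... | just l = anyF≡true⁺ _ l (dec-true (just l ≟ₘ just l) refl)

  count-image : ∀ c → count (image c) ≤ h
  count-image c = begin
    count (image c)                                           ≤⟨ count-anyF (λ a v → dom c a ∧ (copy c a == v)) ⟩
    sumF (λ a → count (λ v → dom c a ∧ (copy c a == v)))      ≤⟨ sumF-≤-* _ 1 image-of-a≤1 ⟩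
    h * 1                                                     ≡⟨ *-identityʳ h ⟩
    h                                                         ∎
    where
    open ≤-Reasoning
    image-of-a≤1 : ∀ a → count (λ v → dom c a ∧ (copy c a == v)) ≤ 1
    image-of-a≤1 a = ≤-trans (count-mono {X = λ v → dom c a ∧ (copy c a == v)} (λ v → ∧-elimʳ {dom c a})) (count-singleton (copy c a))

  count-keptVertex : count keptVertex ≤ t + length family * h
  count-keptVertex = ≤-trans (count-∨ onBoundary (λ v → any (λ c → image c v) family))
                             (+-mono-≤ count-onBoundary (count-any image h family (λ c _ → count-image c)))

  countPairs-keptEdge : countPairs (λ u v → keptEdge u v ∧ not (onBoundary u ∧ onBoundary v)) ≤ length family * (h * h)
  countPairs-keptEdge = ≤-trans (countPairs-mono {Q = λ u v → any (λ c → image c u ∧ image c v) family} viaFamily)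
    (countPairs-any (λ c u v → image c u ∧ image c v) (h * h) family
      (λ c _ → ≤-trans (≤-reflexive (countPairs-∧ (image c) (image c))) (*-mono-≤ (count-image c) (count-image c))))
    where
    viaFamily : ∀ u v → (keptEdge u v ∧ not (onBoundary u ∧ onBoundary v)) ≡ true →
                any (λ c → image c u ∧ image c v) family ≡ true
    viaFamily u v p with ∨-elim {onBoundary u ∧ onBoundary v} (∧-elimʳ {u ~ᴳ v} (∧-elimˡ {keptEdge u v} p))
    ... | inj₂ q = q
    ... | inj₁ q = ⊥-elim (≡true⇒≢false q (not-injective (∧-elimʳ {keptEdge u v} p)))

  module Rerouting (μ⋆-max : ∀ D → IsChunk H D → count (bnd H D) ≤ m)
                   (Y : W → Bool) (|Y|≤h : count Y ≤ h) (s : Slice H t) (|Ds|≤h-|Y| : count (D s) ≤ h ∸ count Y) where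

    private
      Ds : V → Bool
      Ds = D s

    record Embedding (π : V → W) : Set where
      field
        injective   : InjectiveOn Ds π
        avoidsY     : ∀ a → Ds a ≡ true → Y (π a) ≡ false
        homomorphic : HomomorphicOn Ds π
        labelled    : ∀ a → bnd H Ds a ≡ true → L (π a) ≡ just (slab s a)

    Covered : (V → W) → V → Set
    Covered π a = int H Ds a ≡ true →
                  ∃ λ c → c ∈ family × image c (π a) ≡ true × (∀ b → a ~ b ≡ true → image c (π b) ≡ true)

    ∈image : ∀ c {a} → dom c a ≡ true → image c (copy c a) ≡ true
    ∈image c {a} a∈ = anyF≡true⁺ _ a (∧-intro a∈ (==-refl (copy c a)))

    -- Re-embed the component K of x in H[int Ds] by a kept copy of its chunk N[K] that avoids Y and π(Ds ∖ K).
    module Reroute {x : V} (x∈int : int H Ds x ≡ true) (π : V → W) (emb : Embedding π) where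
      open Embedding emb
      open ComponentChunk Ds x∈int

      -- Kept opaque: unfolding these enumeration witnesses makes type checking explode.
      opaque
        enumerated-N[K] : ∃ λ D′ → D′ ∈ functions h (true ∷ false ∷ []) × (∀ a → D′ a ≡ N[K] a)
        enumerated-N[K] = functions-complete h (true ∷ false ∷ []) N[K] bool∈
          where
          bool∈ : ∀ i → N[K] i ∈ true ∷ false ∷ []
          bool∈ i with N[K] i
          ... | true  = here refl
          ... | false = there (here refl)

      D′ : V → Bool
      D′ = proj₁ enumerated-N[K]
      D′≗N[K] : ∀ a → D′ a ≡ N[K] a
      D′≗N[K] = proj₂ (proj₂ enumerated-N[K])

      D′-small : D′ ∈ smallBoundarySets
      D′-small = ∈-filter⁺ smallBoundary? (proj₁ (proj₂ enumerated-N[K]))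
                   (≤-trans (≤-reflexive (count-cong (bnd-cong D′≗N[K]))) (μ⋆-max N[K] N[K]-isChunk))

      int-D′ : ∀ a → int H D′ a ≡ K a
      int-D′ a = trans (int-cong D′≗N[K] a) (int-N[K] a)

      ∈boundaryOf-D′ : ∀ {a} → bnd H N[K] a ≡ true → a ∈ boundaryOf D′
      ∈boundaryOf-D′ {a} b = ∈-filter⁺ (inBoundary? D′) (∈-allFin a) (trans (bnd-cong D′≗N[K] a) b)

      ∈boundaryOf-D′⁻ : ∀ {a} → a ∈ boundaryOf D′ → bnd H N[K] a ≡ true
      ∈boundaryOf-D′⁻ {a} a∈ = trans (sym (bnd-cong D′≗N[K] a))
                                      (proj₂ (∈-filter⁻ (inBoundary? D′) {xs = allFin h} a∈))

      interiorImage⁻ : ∀ ρ {v} → v ∈ interiorImage D′ ρ → ∃ λ a → K a ≡ true × v ≡ ρ a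
      interiorImage⁻ ρ v∈ with a , a∈ , refl ← ∈-map⁻ ρ v∈ =
        a , trans (sym (int-D′ a)) (proj₂ (∈-filter⁻ (inInterior? D′) {xs = allFin h} a∈)) , refl

      interiorImage⁺ : ∀ ρ {a} → K a ≡ true → ρ a ∈ interiorImage D′ ρ
      interiorImage⁺ ρ {a} Ka = ∈-map⁺ ρ (∈-filter⁺ (inInterior? D′) (∈-allFin a) (trans (int-D′ a) Ka))

      ℓs : List (Fin t)
      ℓs = map (slab s) (boundaryOf D′)

      ℓs∈ : ℓs ∈ labelPatterns D′
      ℓs∈ = subst (λ k → ℓs ∈ tuples k (allFin t)) (length-map (slab s) (boundaryOf D′))
                  (tuples-complete (allFin t) ℓs (λ l _ → ∈-allFin l))

      copy-labelled : ∀ {ρ} → IsCopy D′ ℓs ρ → ∀ {a} → bnd H N[K] a ≡ true → L (ρ a) ≡ just (slab s a)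
      copy-labelled (_ , _ , labels) b =
        map-≡⇒≡ (boundaryOf D′) (trans labels (sym (List.map-∘ (boundaryOf D′)))) (∈boundaryOf-D′ b)

      opaque
        enumerated-π : ∃ λ π̃ → π̃ ∈ functions h (allFin (size (gr G))) × (∀ a → π̃ a ≡ π a)
        enumerated-π = functions-complete h (allFin (size (gr G))) π (∈-allFin ∘ π)

      π̃ : V → W
      π̃ = proj₁ enumerated-π
      π̃≗π : ∀ a → π̃ a ≡ π a
      π̃≗π = proj₂ (proj₂ enumerated-π)

      π̃∈copies : π̃ ∈ copies D′ ℓs
      π̃∈copies = ∈-filter⁺ (isCopy? D′ ℓs) (proj₁ (proj₂ enumerated-π)) (injective′ , homomorphic′ , labels′)
        where
        D′⊆Ds : ∀ a → D′ a ≡ true → Ds a ≡ true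
        D′⊆Ds a p = N[K]⊆D a (trans (sym (D′≗N[K] a)) p)
        injective′ : InjectiveOn D′ π̃
        injective′ a b Da Db e = injective a b (D′⊆Ds a Da) (D′⊆Ds b Db) (trans (sym (π̃≗π a)) (trans e (π̃≗π b)))
        homomorphic′ : HomomorphicOn D′ π̃
        homomorphic′ a b Da Db a~b rewrite π̃≗π a | π̃≗π b = homomorphic a b (D′⊆Ds a Da) (D′⊆Ds b Db) a~b
        labels′ : map (L ∘ π̃) (boundaryOf D′) ≡ map just ℓs
        labels′ = trans (List.map-cong-local (All.tabulate λ {a} a∈ →
                          trans (cong L (π̃≗π a)) (labelled a (bnd-N[K]⊆bnd a (∈boundaryOf-D′⁻ a∈)))))
                        (List.map-∘ (boundaryOf D′))

      K⊆Ds : ∀ a → K a ≡ true → Ds a ≡ true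
      K⊆Ds a Ka = int⊆ Ds (K⊆X a Ka)

      π-outside-K : V → W → Bool
      π-outside-K a v = (Ds a ∧ not (K a)) ∧ (π a == v)

      F : W → Bool
      F v = Y v ∨ anyF (λ a → π-outside-K a v)

      |F|≤h : count F ≤ h
      |F|≤h = begin
        count F                                                ≤⟨ count-∨ Y _ ⟩
        count Y + count (λ v → anyF (λ a → π-outside-K a v))  ≤⟨ +-monoʳ-≤ (count Y) (count-anyF π-outside-K) ⟩
        count Y + sumF (λ a → count (π-outside-K a))           ≤⟨ +-monoʳ-≤ (count Y) (sumF-mono-≤ outside≤Ds) ⟩
        count Y + count Ds                                     ≤⟨ +-monoʳ-≤ (count Y) |Ds|≤h-|Y| ⟩
        count Y + (h ∸ count Y)                                ≡⟨ m+[n∸m]≡n |Y|≤h ⟩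
        h                                                      ∎
        where
        open ≤-Reasoning
        outside≤Ds : ∀ a → count (π-outside-K a) ≤ indicator (Ds a)
        outside≤Ds a = begin
          count (π-outside-K a)                            ≡⟨ count-∧ˡ (Ds a ∧ not (K a)) (π a ==_) ⟩
          indicator (Ds a ∧ not (K a)) * count (π a ==_) ≤⟨ *-monoʳ-≤ (indicator (Ds a ∧ not (K a))) (count-singleton (π a)) ⟩
          indicator (Ds a ∧ not (K a)) * 1               ≡⟨ *-identityʳ _ ⟩
          indicator (Ds a ∧ not (K a))                   ≤⟨ indicator-mono (Ds a ∧ not (K a)) (Ds a) ∧-elimˡ ⟩
          indicator (Ds a)                               ∎

      F-intro : ∀ v → Y v ≡ false → (∀ a → Ds a ≡ true → K a ≡ false → π a ≢ v) → F v ≡ false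
      F-intro v Yv unused = cong₂ _∨_ Yv (anyF≡false _ notHit)
        where
        notHit : ∀ a → π-outside-K a v ≡ false
        notHit a with ≡false⊎≡true (π-outside-K a v)
        ... | inj₁ p = p
        ... | inj₂ p = ⊥-elim (unused a (∧-elimˡ (∧-elimˡ p)) (not-injective (∧-elimʳ {Ds a} (∧-elimˡ p))) (==⇒≡ {a = π a} (∧-elimʳ {Ds a ∧ not (K a)} p)))

      F⇒Y : ∀ {v} → F v ≡ false → Y v ≡ false
      F⇒Y {v} = ∨-conicalˡ (Y v) (anyF (λ a → π-outside-K a v))

      F⇒unused : ∀ {v} → F v ≡ false → ∀ a → Ds a ≡ true → K a ≡ false → π a ≢ v
      F⇒unused {v} Fv a Dsa Ka refl =
        ≡true⇒≢false (∨-introʳ {Y v} (anyF≡true⁺ _ a (∧-intro (∧-intro Dsa (cong not Ka)) (==-refl (π a))))) Fv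

      π̃-avoids : Avoids F (interiorImage D′ π̃)
      π̃-avoids = Avoids-intro F _ λ v v∈ → avoid (interiorImage⁻ π̃ v∈)
        where
        avoid : ∀ {v} → (∃ λ a → K a ≡ true × v ≡ π̃ a) → F v ≡ false
        avoid (a , Ka , refl) rewrite π̃≗π a = F-intro (π a) (avoidsY a (K⊆Ds a Ka)) λ a′ Dsa′ Ka′ e →
          ≡true⇒≢false Ka (trans (cong K (sym (injective a′ a Dsa′ (K⊆Ds a Ka) e))) Ka′)

      opaque
        representative : ∃ λ ρ → ρ ∈ representativeCopies D′ ℓs × Avoids F (interiorImage D′ ρ)
        representative = representatives-avoid (interiorImage D′) h (copies D′ ℓs) F |F|≤h π̃∈copies π̃-avoids

      ρ : V → W
      ρ = proj₁ representative

      ρ-copy : IsCopy D′ ℓs ρ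
      ρ-copy = proj₂ (∈-filter⁻ (isCopy? D′ ℓs) {xs = functions h (allFin (size (gr G)))}
                                 (representatives-⊆ (interiorImage D′) h (copies D′ ℓs) (proj₁ (proj₂ representative))))

      c : ChunkCopy
      c = D′ ↦ ρ

      c∈family : c ∈ family
      c∈family = ∈family D′-small ℓs∈ (proj₁ (proj₂ representative))

      ρ-fresh : ∀ a → K a ≡ true → F (ρ a) ≡ false
      ρ-fresh a Ka = Avoids-elim (proj₂ (proj₂ representative)) (interiorImage⁺ ρ Ka)

      ρ≡π-on-bnd : ∀ a → bnd H N[K] a ≡ true → ρ a ≡ π a
      ρ≡π-on-bnd a b = lab-inj G (ρ a) (π a) (slab s a) (copy-labelled ρ-copy b) (labelled a (bnd-N[K]⊆bnd a b))

      π′ : V → W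
      π′ a = if K a then ρ a else π a

      π′-K : ∀ {a} → K a ≡ true → π′ a ≡ ρ a
      π′-K Ka rewrite Ka = refl

      π′-∉K : ∀ {a} → K a ≡ false → π′ a ≡ π a
      π′-∉K Ka rewrite Ka = refl

      -- A neighbour of K outside K lies on ∂N[K], where ρ and π agree.
      π′≡ρ-near-K : ∀ {a b} → K a ≡ true → a ~ b ≡ true → π′ b ≡ ρ b
      π′≡ρ-near-K {a} {b} Ka a~b with ≡false⊎≡true (K b)
      ... | inj₂ Kb = π′-K Kb
      ... | inj₁ Kb = trans (π′-∉K Kb) (sym (ρ≡π-on-bnd b (neighbour∉K⇒bnd-N[K] a b Ka a~b Kb)))

      D′-near-K : ∀ {a b} → K a ≡ true → a ~ b ≡ true → D′ b ≡ true
      D′-near-K {a} {b} Ka a~b = trans (D′≗N[K] b) (neighbour∈N[K] a b Ka a~b)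

      D′-K : ∀ {a} → K a ≡ true → D′ a ≡ true
      D′-K {a} Ka = trans (D′≗N[K] a) (K⊆N[K] a Ka)

      ρ-unused : ∀ {a a′} → K a ≡ true → Ds a′ ≡ true → K a′ ≡ false → π a′ ≢ ρ a
      ρ-unused Ka = F⇒unused (ρ-fresh _ Ka) _

      embedding′ : Embedding π′
      embedding′ = record { injective = injective′ ; avoidsY = avoidsY′ ; homomorphic = homomorphic′ ; labelled = labelled′ }
        where
        injective′ : InjectiveOn Ds π′
        injective′ a b Dsa Dsb e with ≡false⊎≡true (K a) | ≡false⊎≡true (K b)
        ... | inj₂ Ka | inj₂ Kb = proj₁ ρ-copy a b (D′-K Ka) (D′-K Kb) (trans (sym (π′-K Ka)) (trans e (π′-K Kb)))
        ... | inj₂ Ka | inj₁ Kb = ⊥-elim (ρ-unused Ka Dsb Kb (trans (sym (π′-∉K Kb)) (trans (sym e) (π′-K Ka))))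
        ... | inj₁ Ka | inj₂ Kb = ⊥-elim (ρ-unused Kb Dsa Ka (trans (sym (π′-∉K Ka)) (trans e (π′-K Kb))))
        ... | inj₁ Ka | inj₁ Kb = injective a b Dsa Dsb (trans (sym (π′-∉K Ka)) (trans e (π′-∉K Kb)))
        avoidsY′ : ∀ a → Ds a ≡ true → Y (π′ a) ≡ false
        avoidsY′ a Dsa with ≡false⊎≡true (K a)
        ... | inj₂ Ka = trans (cong Y (π′-K Ka)) (F⇒Y (ρ-fresh a Ka))
        ... | inj₁ Ka = trans (cong Y (π′-∉K Ka)) (avoidsY a Dsa)
        homomorphic′ : HomomorphicOn Ds π′
        homomorphic′ a b Dsa Dsb a~b with ≡false⊎≡true (K a) | ≡false⊎≡true (K b)
        ... | inj₁ Ka | inj₁ Kb rewrite π′-∉K Ka | π′-∉K Kb = homomorphic a b Dsa Dsb a~b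
        ... | inj₂ Ka | _ rewrite π′-K Ka | π′≡ρ-near-K Ka a~b = proj₁ (proj₂ ρ-copy) a b (D′-K Ka) (D′-near-K Ka a~b) a~b
        ... | inj₁ Ka | inj₂ Kb rewrite π′-K Kb | π′≡ρ-near-K Kb (~-sym a~b) =
          proj₁ (proj₂ ρ-copy) a b (D′-near-K Kb (~-sym a~b)) (D′-K Kb) a~b
        labelled′ : ∀ a → bnd H Ds a ≡ true → L (π′ a) ≡ just (slab s a)
        labelled′ a b = trans (cong L (π′-∉K (bnd⇒∉K a b))) (labelled a b)

      covered-K : ∀ {a} → K a ≡ true → Covered π′ a
      covered-K {a} Ka _ = c , c∈family
                         , subst (λ v → image c v ≡ true) (sym (π′-K Ka)) (∈image c (D′-K Ka))
                         , λ b a~b → subst (λ v → image c v ≡ true) (sym (π′≡ρ-near-K Ka a~b)) (∈image c (D′-near-K Ka a~b))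

      covered-preserved : ∀ a → Covered π a → Covered π′ a
      covered-preserved a covered with ≡false⊎≡true (K a)
      ... | inj₂ Ka = covered-K Ka
      ... | inj₁ Ka = λ a∈int → let c , c∈ , πa∈ , πb∈ = covered a∈int in
        c , c∈ , subst (λ v → image c v ≡ true) (sym (π′-∉K Ka)) πa∈
          , λ b a~b → subst (λ v → image c v ≡ true) (sym (π′-∉K (neighbour∉K a∈int a~b))) (πb∈ b a~b)
        where
        neighbour∉K : ∀ {b} → int H Ds a ≡ true → a ~ b ≡ true → K b ≡ false
        neighbour∉K {b} a∈int a~b with K b in Kb
        ... | false = refl
        ... | true  = ⊥-elim (≡true⇒≢false (K-closed b a Kb a∈int (~-sym a~b)) Ka)

    reroute : ∀ x π → Embedding π → ∃ λ π′ → Embedding π′ × (∀ a → Covered π a → Covered π′ a) × Covered π′ x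
    reroute x π emb with ≡false⊎≡true (int H Ds x)
    ... | inj₁ x∉int = π , emb , (λ _ covered → covered) , λ x∈int → ⊥-elim (≡true⇒≢false x∈int x∉int)
    ... | inj₂ x∈int = π′ , embedding′ , covered-preserved , covered-K (Component.x∈K (component (int H Ds) x x∈int))
      where open Reroute x∈int π emb

    reroute-all : ∀ xs π → Embedding π →
                  ∃ λ π′ → Embedding π′ × (∀ a → Covered π a → Covered π′ a) × (∀ a → a ∈ xs → Covered π′ a)
    reroute-all []       π emb = π , emb , (λ _ covered → covered) , λ _ ()
    reroute-all (x ∷ xs) π emb with π₁ , emb₁ , keep₁ , x-covered ← reroute x π emb
                               with π₂ , emb₂ , keep₂ , xs-covered ← reroute-all xs π₁ emb₁ =
      π₂ , emb₂ , (λ a → keep₂ a ∘ keep₁ a) , λ { a (here refl) → keep₂ a x-covered ; a (there a∈) → xs-covered a a∈ }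

    embedding-in-Ĝ : ∀ π → Embedding π → (∀ a → Covered π a) → Embeds H s (delV H Y keptVertex) keptEdge (delL H Y L)
    embedding-in-Ĝ π emb covered = π , injective , kept , edges , labels
      where
      open Embedding emb
      onBoundary-π : ∀ a → bnd H Ds a ≡ true → onBoundary (π a) ≡ true
      onBoundary-π a b rewrite labelled a b = refl
      kept : ∀ a → Ds a ≡ true → delV H Y keptVertex (π a) ≡ true
      kept a Dsa = ∧-intro keptπa (cong not (avoidsY a Dsa))
        where
        keptπa : keptVertex (π a) ≡ true
        keptπa with ≡false⊎≡true (bnd H Ds a)
        ... | inj₂ b = ∨-introˡ (onBoundary-π a b)
        ... | inj₁ b with c , c∈ , πa∈ , _ ← covered a (int-intro Ds Dsa b) =
          ∨-introʳ {onBoundary (π a)} (any≡true⁺ (λ c → image c (π a)) c∈ πa∈)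
      edges : ∀ a b → Ds a ≡ true → Ds b ≡ true → a ~ b ≡ true → keptEdge (π a) (π b) ≡ true
      edges a b Dsa Dsb a~b = ∧-intro (homomorphic a b Dsa Dsb a~b) viaBoundaryOrCopy
        where
        viaBoundaryOrCopy : ((onBoundary (π a) ∧ onBoundary (π b)) ∨ any (λ c → image c (π a) ∧ image c (π b)) family) ≡ true
        viaBoundaryOrCopy with ≡false⊎≡true (int H Ds a) | ≡false⊎≡true (int H Ds b)
        ... | inj₂ a∈int | _ with c , c∈ , πa∈ , πb∈ ← covered a a∈int =
          ∨-introʳ {onBoundary (π a) ∧ onBoundary (π b)} (any≡true⁺ _ c∈ (∧-intro πa∈ (πb∈ b a~b)))
        viaBoundaryOrCopy | inj₁ _ | inj₂ b∈int with c , c∈ , πb∈ , πa∈ ← covered b b∈int =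
          ∨-introʳ {onBoundary (π a) ∧ onBoundary (π b)} (any≡true⁺ _ c∈ (∧-intro (πa∈ a (~-sym a~b)) πb∈))
        viaBoundaryOrCopy | inj₁ a∉int | inj₁ b∉int =
          ∨-introˡ (∧-intro (onBoundary-π a (∖int⇒bnd Ds Dsa a∉int)) (onBoundary-π b (∖int⇒bnd Ds Dsb b∉int)))
      labels : ∀ a → bnd H Ds a ≡ true → delL H Y L (π a) ≡ just (slab s a)
      labels a b rewrite avoidsY a (bnd⊆ Ds b) = labelled a b

    toEmbedding : (e : Embeds H s (delV H Y (λ _ → true)) (adj (gr G)) (delL H Y L)) → Embedding (proj₁ e)
    toEmbedding (π , injective , notDeleted , homomorphic , labelled) = record
      { injective = injective ; avoidsY = avoidsY ; homomorphic = homomorphic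
      ; labelled = λ a b → trans (cong (λ y → if y then nothing else L (π a)) (sym (avoidsY a (bnd⊆ Ds b)))) (labelled a b) }
      where
      avoidsY : ∀ a → Ds a ≡ true → Y (π a) ≡ false
      avoidsY a Dsa = not-injective (notDeleted a Dsa)

    witness : Embeds H s (delV H Y (λ _ → true)) (adj (gr G)) (delL H Y L) →
              Embeds H s (delV H Y keptVertex) keptEdge (delL H Y L)
    witness e with π′ , emb′ , _ , covered ← reroute-all (allFin h) (proj₁ e) (toEmbedding e) =
      embedding-in-Ĝ π′ emb′ (λ a → covered a (∈-allFin a))

  keptEdge-onBoundary : ∀ {u v} → onBoundary u ≡ true → onBoundary v ≡ true → keptEdge u v ≡ u ~ᴳ v
  keptEdge-onBoundary {u} {v} ∂u ∂v rewrite ∂u | ∂v = ∧-identityʳ (u ~ᴳ v)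

  Ĝ-size : 1 ≤ m → count keptVertex + countPairs (λ u v → keptEdge u v ∧ not (onBoundary u ∧ onBoundary v))
                     ≤ sizeConstant h * suc t ^ m
  Ĝ-size 1≤m = begin
    count keptVertex + countPairs (λ u v → keptEdge u v ∧ not (onBoundary u ∧ onBoundary v))
      ≤⟨ +-mono-≤ count-keptVertex countPairs-keptEdge ⟩
    t + length family * h + length family * (h * h)
      ≤⟨ +-mono-≤ (+-mono-≤ t≤T (*-monoˡ-≤ h length-family)) (*-monoˡ-≤ (h * h) length-family) ⟩
    T + P * (T * g) * h + P * (T * g) * (h * h)
      ≡⟨ collect P g h T ⟨
    sizeConstant h * T ∎
    where
    open ≤-Reasoning
    T = suc t ^ m
    P = 2 ^ h
    g = repBound h h
    t≤T : t ≤ T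
    t≤T = ≤-trans (≤-trans (≤-reflexive (sym (*-identityʳ t))) (*-monoˡ-≤ 1 (n≤1+n t))) (^-monoʳ-≤ (suc t) 1≤m)
    collect : ∀ P g h T → (1 + P * g * h + P * g * (h * h)) * T ≡ T + P * (T * g) * h + P * (T * g) * (h * h)
    collect = solve-∀

  G-witnessSub-Ĝ : (∀ D → IsChunk H D → count (bnd H D) ≤ m) → WitnessSub H L (λ _ → true) (adj (gr G)) keptVertex keptEdge
  G-witnessSub-Ĝ μ⋆-max Y _ |Y|≤h s (|Ds|≤ , e) = |Ds|≤ , Rerouting.witness μ⋆-max Y |Y|≤h s |Ds|≤ e

witnessSub-⊆ : ∀ H {t n} (lab : Fin n → Maybe (Fin t)) {V₁ V₂ : Fin n → Bool} {E₁ E₂ : Fin n → Fin n → Bool} →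
               (∀ v → V₁ v ≡ true → V₂ v ≡ true) → (∀ u v → E₁ u v ≡ true → E₂ u v ≡ true) →
               WitnessSub H lab V₁ E₁ V₂ E₂
witnessSub-⊆ H lab {V₁} {V₂} V₁⊆V₂ E₁⊆E₂ Y _ _ s (|Ds|≤ , π , injective , kept , edges , labels) =
  |Ds|≤ , π , injective , (λ a Dsa → keptInV₂ (kept a Dsa)) , (λ a b Dsa Dsb a~b → E₁⊆E₂ _ _ (edges a b Dsa Dsb a~b)) , labels
  where
  keptInV₂ : ∀ {v} → delV H Y V₁ v ≡ true → delV H Y V₂ v ≡ true
  keptInV₂ {v} p = ∧-intro (V₁⊆V₂ v (∧-elimˡ p)) (∧-elimʳ {V₁ v} p)

lemma7 : (H : Graph) → HasNonCliqueComponent H → (m : ℕ) → IsMuStar H m →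
    Σ ℕ λ C → ∀ (t : ℕ) (G : BGraph t) → Σ (SubGraph G) λ Ĝ →
      (∀ v → is-just (lab G v) ≡ true → S Ĝ v ≡ true)
      × (∀ u v → is-just (lab G u) ≡ true → is-just (lab G v) ≡ true → E' Ĝ u v ≡ adj (gr G) u v)
      × WitnessSub H (lab G) (λ _ → true) (adj (gr G)) (S Ĝ) (E' Ĝ)
      × WitnessSub H (lab G) (S Ĝ) (E' Ĝ) (λ _ → true) (adj (gr G))
      × count (S Ĝ) + countPairs (λ u v → E' Ĝ u v ∧ not (is-just (lab G u) ∧ is-just (lab G v))) ≤ C * suc t ^ m
lemma7 H nonClique m μ⋆@(_ , μ⋆-max) = sizeConstant (size H) , λ t G → let open Sparsifier H m G in
    Ĝ
  , (λ v → ∨-introˡ)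
  , (λ u v → keptEdge-onBoundary)
  , G-witnessSub-Ĝ μ⋆-max
  , witnessSub-⊆ H (lab G) {keptVertex} (λ _ _ → refl) (λ u v → SubGraph.E'⊆E Ĝ u v)
  , Ĝ-size (Chunks.μ⋆-positive H nonClique μ⋆)
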